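{- Fix any total ordering of the edges of the thread $T_m$ and define signs of prestar labellings with respect to it. (a) For each odd $m\ge1$, $\operatorname{sgn}(\pi_{20})=\operatorname{sgn}(\pi_{02})$. (b) For $m=1$, $\operatorname{sgn}(\pi'_{11})=-\operatorname{sgn}(\pi_{02})$. (c) For each even $m\ge2$, $\operatorname{sgn}(\rho_{02})=\operatorname{sgn}(\rho_{20})$.
   Context: For $m\ge0$, the thread $T_m$ is obtained from a path $v_0e_0v_1e_1\cdots e_mv_{m+1}$ ($e_k=v_kv_{k+1}$) by adding vertices $w_k$ and edges $f_k=v_kw_k$ for $1\le k\le m$. A flag is an incident vertex–edge pair, written $ve$. A prestar labelling is a function $\pi$ from flags to $\{0,1,2\}$ such that for each $1\le k\le m$, the values on $v_ke_{k-1},v_ke_k,v_kf_k$ are $0,1,2$ in some order. Given a total order on $E(T_m)$, the sign of $\pi$ at $v_k$ is the sign of the permutation $j\mapsto \pi(v_ka_j)$ of $\{0,1,2\}$, where $a_0<a_1<a_2$ are the three edges at $v_k$ in the given order, and $\operatorname{sgn}(\pi)=\prod_{k=1}^m(\text{sign at }v_k)$. All labellings below give value $1$ to every flag $w_kf_k$. $\pi_{20}$ ($m\ge1$): $\pi(v_0e_0)=2$; at $v_1$: $e_0\mapsto1$, $f_1\mapsto2$, $e_1\mapsto0$; at $v_k$ ($2\le k\le m$): $e_{k-1}\mapsto0$, $f_k\mapsto1$, $e_k\mapsto2$; $\pi(v_{m+1}e_m)=0$. $\pi_{02}$ ($m\ge1$): $\pi(v_0e_0)=0$; at $v_1$: $e_0\mapsto1$,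 $f_1\mapsto2$, $e_1\mapsto0$; at $v_k$ ($2\le k\le m$): $e_{k-1}\mapsto2$, $f_k\mapsto1$, $e_k\mapsto0$; $\pi(v_{m+1}e_m)=2$. $\pi'_{11}$ ($m=1$): $\pi(v_0e_0)=1$; at $v_1$: $e_0\mapsto0$, $f_1\mapsto2$, $e_1\mapsto1$; $\pi(v_2e_1)=1$. $\rho_{20}$: $\pi(v_0e_0)=2$; at each $v_k$: $e_{k-1}\mapsto0$, $f_k\mapsto1$, $e_k\mapsto2$; $\pi(v_{m+1}e_m)=0$. $\rho_{02}$: $\pi(v_0e_0)=0$; at each $v_k$: $e_{k-1}\mapsto2$, $f_k\mapsto1$, $e_k\mapsto0$; $\pi(v_{m+1}e_m)=2$. -}

module Defs where

open import Data.Nat using (ℕ; zero; suc; _≡ᵇ_)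
open import Data.Fin using (Fin; zero; suc; toℕ; inject₁)
open import Data.Bool using (Bool; true; false; if_then_else_)
open import Data.Sign using (Sign; +; -) renaming (_*_ to _·_)
open import Data.List using (List; map; foldr; allFin)
open import Data.Product using (_×_; _,_; proj₁; proj₂)
open import Relation.Binary using (Rel; IsStrictTotalOrder; Tri; tri<; tri≈; tri>)
open import Relation.Binary.PropositionalEquality using (_≡_)
open import Level using (0ℓ)

-- The thread T_m.
-- Vertices: v_0 … v_{m+1}  and  w_1 … w_m   (w i  stands for w_{i+1}).
data Vertex (m : ℕ) : Set where
  v : Fin (suc (suc m)) → Vertex m
  w : Fin m → Vertex m

-- Edges: e_0 … e_m (e_i = v_i v_{i+1})  and  f_1 … f_m  (f i stands for f_{i+1}).
data Edge (m : ℕ) : Set where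
  e : Fin (suc m) → Edge m
  f : Fin m → Edge m

-- Flags (incident vertex–edge pairs), enumerated explicitly:
--   vl i  = v_i e_i ,   vr i = v_{i+1} e_i ,
--   vf k  = v_{k+1} f_{k+1} ,   wf k = w_{k+1} f_{k+1}.
data Flag (m : ℕ) : Set where
  vl : Fin (suc m) → Flag m
  vr : Fin (suc m) → Flag m
  vf : Fin m → Flag m
  wf : Fin m → Flag m

vertexOf : ∀ {m} → Flag m → Vertex m
vertexOf (vl i) = v (inject₁ i)
vertexOf (vr i) = v (suc i)
vertexOf (vf k) = v (suc (inject₁ k))
vertexOf (wf k) = w k

edgeOf : ∀ {m} → Flag m → Edge m
edgeOf (vl i) = e i
edgeOf (vr i) = e i
edgeOf (vf k) = f k
edgeOf (wf k) = f k

data L : Set where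
  l0 l1 l2 : L

Labelling : ℕ → Set
Labelling m = Flag m → L

-- Sign of the map j ↦ x_j of {0,1,2} (meaningful when it is a permutation;
-- non-permutations, which never occur for prestar labellings, get +).
permSign : L → L → L → Sign
permSign l0 l1 l2 = +
permSign l1 l2 l0 = +
permSign l2 l0 l1 = +
permSign l0 l2 l1 = -
permSign l2 l1 l0 = -
permSign l1 l0 l2 = -
permSign _  _  _  = +

module _ {m : ℕ} {_<_ : Rel (Edge m) 0ℓ} (ord : IsStrictTotalOrder _≡_ _<_) where
  open IsStrictTotalOrder ord using (compare)

  lt : Edge m → Edge m → Bool
  lt a b with compare a b
  ... | tri< _ _ _ = true
  ... | tri≈ _ _ _ = false
  ... | tri> _ _ _ = false

  EL = Edge m × L

  sort2 : EL → EL → EL × EL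
  sort2 p q = if lt (proj₁ p) (proj₁ q) then (p , q) else (q , p)

  sort3 : EL → EL → EL → EL × EL × EL
  sort3 p q r with sort2 p q
  ... | (a , b) =
    if lt (proj₁ r) (proj₁ a) then (r , a , b)
    else (if lt (proj₁ r) (proj₁ b) then (a , r , b) else (a , b , r))

  -- sign of π at the internal vertex v_{k+1}: edges there are e_k, f_{k+1}, e_{k+1};
  -- with a_0 < a_1 < a_2 these edges in the given order, take the sign of j ↦ π(v a_j).
  signAt : Labelling m → Fin m → Sign
  signAt π k with sort3 (e (inject₁ k) , π (vr (inject₁ k)))
                        (f k , π (vf k))
                        (e (suc k) , π (vl (suc k)))
  ... | ((_ , x) , (_ , y) , (_ , z)) = permSign x y z

  sgn : Labelling m → Sign
  sgn π = foldr _·_ + (map (signAt π) (allFin m))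

case012 : ℕ → L → L → L → L
case012 zero a b c = a
case012 (suc zero) a b c = b
case012 (suc (suc _)) a b c = c

case01 : ℕ → L → L → L
case01 zero a b = a
case01 (suc _) a b = b

π20 : (m : ℕ) → Labelling m
π20 m (vl i) = case012 (toℕ i) l2 l0 l2
π20 m (vr i) = if toℕ i ≡ᵇ m then l0
               else case01 (toℕ i) l1 l0
π20 m (vf k) = case01 (toℕ k) l2 l1
π20 m (wf k) = l1

π02 : (m : ℕ) → Labelling m
π02 m (vl i) = case012 (toℕ i) l0 l0 l0
π02 m (vr i) = if toℕ i ≡ᵇ m then l2
               else case01 (toℕ i) l1 l2
π02 m (vf k) = case01 (toℕ k) l2 l1
π02 m (wf k) = l1

π'11 : Labelling 1
π'11 (vl zero) = l1
π'11 (vl (suc zero)) = l1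
π'11 (vr zero) = l0
π'11 (vr (suc zero)) = l1
π'11 (vf zero) = l2
π'11 (wf zero) = l1

ρ20 : (m : ℕ) → Labelling m
ρ20 m (vl i) = l2
ρ20 m (vr i) = l0
ρ20 m (vf k) = l1
ρ20 m (wf k) = l1

ρ02 : (m : ℕ) → Labelling m
ρ02 m (vl i) = l0
ρ02 m (vr i) = l2
ρ02 m (vf k) = l1
ρ02 m (wf k) = l1

-- At every vertex v_k the sign of a labelling is the sign of the labels read in the order
-- e_{k-1}, f_k, e_k, composed with the permutation sorting these three edges; the latter
-- depends only on the edge order. Hence two labellings whose labels at v_k differ by a
-- transposition of {0,1,2} have opposite signs at v_k. In (a) this happens at the m - 1
-- vertices v_2, …, v_m (labels 0,1,2 against 2,1,0) while v_1 carries the same labels; in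
-- (c) at all m vertices; in (b) at the single vertex v_1 (labels 1,2,0 against 0,2,1).
-- An even number of sign flips leaves the product unchanged.
module Submission where

open import Defs
open import Data.Nat as ℕ using (ℕ; suc; _*_; _≡ᵇ_)
open import Data.Fin using (Fin; zero; suc; toℕ; inject₁)
open import Data.Bool using (true; false; if_then_else_)
open import Data.Product using (_×_; _,_)
open import Data.List using (foldr; tabulate)
open import Data.List.Properties using (map-tabulate)
open import Data.Sign using (Sign; +; -; opposite) renaming (_*_ to _·_)
open import Data.Sign.Properties using (opposite-involutive; *-identityʳ)
open import Function using (id; _∘_)
open import Relation.Binary using (Rel; IsStrictTotalOrder)
open import Relation.Binary.PropositionalEquality
  using (_≡_; refl; sym; cong; cong₂; module ≡-Reasoning)
open import Level using (0ℓ)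

Triple : Set → Set
Triple A = A × A × A

data Arrangement : Set where
  abc acb bac bca cab cba : Arrangement

arrange : ∀ {A : Set} → Arrangement → Triple A → Triple A
arrange abc (x , y , z) = x , y , z
arrange acb (x , y , z) = x , z , y
arrange bac (x , y , z) = y , x , z
arrange bca (x , y , z) = y , z , x
arrange cab (x , y , z) = z , x , y
arrange cba (x , y , z) = z , y , x

arrangedSign : Arrangement → Triple L → Sign
arrangedSign P t with arrange P t
... | x , y , z = permSign x y z

arrangedSign-swap₀₂ : ∀ P → arrangedSign P (l2 , l1 , l0) ≡ opposite (arrangedSign P (l0 , l1 , l2))
arrangedSign-swap₀₂ abc = refl
arrangedSign-swap₀₂ acb = refl
arrangedSign-swap₀₂ bac = refl
arrangedSign-swap₀₂ bca = refl
arrangedSign-swap₀₂ cab = refl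
arrangedSign-swap₀₂ cba = refl

arrangedSign-swap₀₁ : ∀ P → arrangedSign P (l0 , l2 , l1) ≡ opposite (arrangedSign P (l1 , l2 , l0))
arrangedSign-swap₀₁ abc = refl
arrangedSign-swap₀₁ acb = refl
arrangedSign-swap₀₁ bac = refl
arrangedSign-swap₀₁ bca = refl
arrangedSign-swap₀₁ cab = refl
arrangedSign-swap₀₁ cba = refl

∏ : ∀ {m} → (Fin m → Sign) → Sign
∏ s = foldr _·_ + (tabulate s)

opposite-·-opposite : ∀ a b r → opposite a · (opposite b · r) ≡ a · (b · r)
opposite-·-opposite + + r = opposite-involutive r
opposite-·-opposite + - r = refl
opposite-·-opposite - + r = refl
opposite-·-opposite - - r = sym (opposite-involutive r)

∏-evenFlips : ∀ n {s t : Fin (n * 2) → Sign} →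
  (∀ k → t k ≡ opposite (s k)) → ∏ t ≡ ∏ s
∏-evenFlips ℕ.zero _ = refl
∏-evenFlips (suc n) {s} {t} t≡-s = begin
  t zero · (t (suc zero) · ∏ (λ k → t (suc (suc k))))
    ≡⟨ cong₂ _·_ (t≡-s zero) (cong₂ _·_ (t≡-s (suc zero))
                   (∏-evenFlips n (λ k → t≡-s (suc (suc k))))) ⟩
  opposite (s zero) · (opposite (s (suc zero)) · ∏ (λ k → s (suc (suc k))))
    ≡⟨ opposite-·-opposite (s zero) (s (suc zero)) _ ⟩
  s zero · (s (suc zero) · ∏ (λ k → s (suc (suc k)))) ∎
  where open ≡-Reasoning

labelsAt : ∀ {m} → Labelling m → Fin m → Triple L
labelsAt π k = π (vr (inject₁ k)) , π (vf k) , π (vl (suc k))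

sgn-∏ : ∀ {m} {_<_ : Rel (Edge m) 0ℓ} (ord : IsStrictTotalOrder _≡_ _<_) (π : Labelling m) →
  sgn ord π ≡ ∏ (signAt ord π)
sgn-∏ ord π = cong (foldr _·_ +) (map-tabulate id (signAt ord π))

module _ {m : ℕ} {_<_ : Rel (Edge m) 0ℓ} (ord : IsStrictTotalOrder _≡_ _<_) where

  sortingArrangement : Edge m → Edge m → Edge m → Arrangement
  sortingArrangement a b c with lt ord a b
  ... | true  = if lt ord c a then cab else if lt ord c b then acb else abc
  ... | false = if lt ord c b then cba else if lt ord c a then bca else bac

  sort3-arrange : ∀ a b c (x y z : L) →
    sort3 ord (a , x) (b , y) (c , z) ≡ arrange (sortingArrangement a b c) ((a , x) , (b , y) , (c , z))
  sort3-arrange a b c x y z with lt ord a b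
  ... | true with lt ord c a
  ...   | true = refl
  ...   | false with lt ord c b
  ...     | true = refl
  ...     | false = refl
  sort3-arrange a b c x y z | false with lt ord c b
  ...   | true = refl
  ...   | false with lt ord c a
  ...     | true = refl
  ...     | false = refl

  sortingAt : Fin m → Arrangement
  sortingAt k = sortingArrangement (e (inject₁ k)) (f k) (e (suc k))

  signAt-arranged : ∀ π k → signAt ord π k ≡ arrangedSign (sortingAt k) (labelsAt π k)
  signAt-arranged π k
    rewrite sort3-arrange (e (inject₁ k)) (f k) (e (suc k)) (π (vr (inject₁ k))) (π (vf k)) (π (vl (suc k)))
    with sortingAt k
  ... | abc = refl
  ... | acb = refl
  ... | bac = refl
  ... | bca = refl
  ... | cab = refl
  ... | cba = refl

  signAt-flip : ∀ (π π' : Labelling m) k {t t' : Triple L} →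
    (∀ P → arrangedSign P t' ≡ opposite (arrangedSign P t)) →
    labelsAt π k ≡ t → labelsAt π' k ≡ t' → signAt ord π' k ≡ opposite (signAt ord π k)
  signAt-flip π π' k {t} {t'} flip πk≡t π'k≡t' = begin
    signAt ord π' k                              ≡⟨ signAt-arranged π' k ⟩
    arrangedSign (sortingAt k) (labelsAt π' k)   ≡⟨ cong (arrangedSign (sortingAt k)) π'k≡t' ⟩
    arrangedSign (sortingAt k) t'                ≡⟨ flip (sortingAt k) ⟩
    opposite (arrangedSign (sortingAt k) t)      ≡⟨ cong (opposite ∘ arrangedSign (sortingAt k)) (sym πk≡t) ⟩
    opposite (arrangedSign (sortingAt k) (labelsAt π k)) ≡⟨ cong opposite (sym (signAt-arranged π k)) ⟩
    opposite (signAt ord π k)                    ∎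
    where open ≡-Reasoning

inject₁-notLast : ∀ {m} (i : Fin m) → (toℕ (inject₁ i) ≡ᵇ m) ≡ false
inject₁-notLast zero    = refl
inject₁-notLast (suc i) = inject₁-notLast i

π20-inner : ∀ {m} (j : Fin m) → labelsAt (π20 (suc m)) (suc j) ≡ (l0 , l1 , l2)
π20-inner j rewrite inject₁-notLast j = refl

π02-inner : ∀ {m} (j : Fin m) → labelsAt (π02 (suc m)) (suc j) ≡ (l2 , l1 , l0)
π02-inner j rewrite inject₁-notLast j = refl

sgn-π20≡sgn-π02 : ∀ n {_<_ : Rel (Edge (suc (n * 2))) 0ℓ} (ord : IsStrictTotalOrder _≡_ _<_) →
  sgn ord (π20 (suc (n * 2))) ≡ sgn ord (π02 (suc (n * 2)))
sgn-π20≡sgn-π02 n ord = begin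
  sgn ord π                                  ≡⟨ sgn-∏ ord π ⟩
  signAt ord π zero · ∏ (signAt ord π ∘ suc)
    ≡⟨ cong (signAt ord π zero ·_) (sym (∏-evenFlips n
         (λ j → signAt-flip ord π π' (suc j) arrangedSign-swap₀₂ (π20-inner j) (π02-inner j)))) ⟩
  signAt ord π' zero · ∏ (signAt ord π' ∘ suc) ≡⟨ sgn-∏ ord π' ⟨
  sgn ord π'                                 ∎
  where
  open ≡-Reasoning
  π = π20 (suc (n * 2))
  π' = π02 (suc (n * 2))

sgn-π'11≡-sgn-π02 : ∀ {_<_ : Rel (Edge 1) 0ℓ} (ord : IsStrictTotalOrder _≡_ _<_) →
  sgn ord π'11 ≡ opposite (sgn ord (π02 1))
sgn-π'11≡-sgn-π02 ord = begin
  signAt ord π'11 zero · +             ≡⟨ *-identityʳ _ ⟩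
  signAt ord π'11 zero                 ≡⟨ signAt-flip ord (π02 1) π'11 zero arrangedSign-swap₀₁ refl refl ⟩
  opposite (signAt ord (π02 1) zero)   ≡⟨ cong opposite (*-identityʳ _) ⟨
  opposite (signAt ord (π02 1) zero · +) ∎
  where open ≡-Reasoning

sgn-ρ02≡sgn-ρ20 : ∀ n {_<_ : Rel (Edge (suc n * 2)) 0ℓ} (ord : IsStrictTotalOrder _≡_ _<_) →
  sgn ord (ρ02 (suc n * 2)) ≡ sgn ord (ρ20 (suc n * 2))
sgn-ρ02≡sgn-ρ20 n ord = begin
  sgn ord (ρ02 (suc n * 2))              ≡⟨ sgn-∏ ord (ρ02 (suc n * 2)) ⟩
  ∏ (signAt ord (ρ02 (suc n * 2)))
    ≡⟨ ∏-evenFlips (suc n) (λ k → signAt-flip ord (ρ20 _) (ρ02 _) k arrangedSign-swap₀₂ refl refl) ⟩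
  ∏ (signAt ord (ρ20 (suc n * 2)))       ≡⟨ sgn-∏ ord (ρ20 (suc n * 2)) ⟨
  sgn ord (ρ20 (suc n * 2))              ∎
  where open ≡-Reasoning

proposition3p2 :
  (∀ (n : ℕ) (_<_ : Rel (Edge (suc (n * 2))) 0ℓ) (ord : IsStrictTotalOrder _≡_ _<_)
     → sgn ord (π20 (suc (n * 2))) ≡ sgn ord (π02 (suc (n * 2))))
  × (∀ (_<_ : Rel (Edge 1) 0ℓ) (ord : IsStrictTotalOrder _≡_ _<_)
     → sgn ord π'11 ≡ opposite (sgn ord (π02 1)))
  × (∀ (n : ℕ) (_<_ : Rel (Edge (suc (suc (n * 2)))) 0ℓ) (ord : IsStrictTotalOrder _≡_ _<_)
     → sgn ord (ρ02 (suc (suc (n * 2)))) ≡ sgn ord (ρ20 (suc (suc (n * 2)))))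
proposition3p2 =
    (λ n _ → sgn-π20≡sgn-π02 n)
  , (λ _ → sgn-π'11≡-sgn-π02)
  , (λ n _ → sgn-ρ02≡sgn-ρ20 n)
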